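{- In every ${}^\infty$-algebra $(K,+,\cdot,{}^\infty,0,1)$ the following hold for all $a,b\in K$: (1) $a^n\ge a^\infty$ and $a^na^\infty=a^\infty$ for all $n\in\mathbb{N}$; (2) $a^\infty a^\infty=a^\infty$; (3) $(a^\infty)^\infty=a^\infty$; (4) $(ab)^\infty=a^\infty b^\infty$; (5) $(a+b)^\infty=a^\infty+b^\infty$.
   Context: An ${}^\infty$-algebra is a structure $(K,+,\cdot,{}^\infty,0,1)$ such that $(K,+,\cdot,0,1)$ is an absorptive commutative semiring (i.e. $1+a=1$ for all $a$) and the unary operation ${}^\infty$ satisfies $a^\infty=a\,a^\infty$ and the implication $b\le c+ab\ \Rightarrow\ b\le c+a^\infty b$ for all $a,b,c$, where $\le$ is the natural order ($x\le y$ iff $x+y=y$). -}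

module Defs where

open import Level using (Level; suc; _⊔_)
open import Data.Nat.Base using (ℕ)
open import Algebra.Bundles using (CommutativeSemiring)
import Algebra.Definitions.RawSemiring as RS

record InfAlgebra (c ℓ : Level) : Set (suc (c ⊔ ℓ)) where
  infix 4 _≤_
  infixl 10 _^∞
  field
    commutativeSemiring : CommutativeSemiring c ℓ
  open CommutativeSemiring commutativeSemiring public
  open RS rawSemiring public using (_^_)

  _≤_ : Carrier → Carrier → Set ℓ
  x ≤ y = x + y ≈ y

  field
    _^∞        : Carrier → Carrier
    ^∞-cong    : ∀ {x y} → x ≈ y → x ^∞ ≈ y ^∞
    absorptive : ∀ a → 1# + a ≈ 1#
    ^∞-unfold  : ∀ a → a ^∞ ≈ a * a ^∞
    ^∞-induct  : ∀ a b c → b ≤ c + a * b → b ≤ c + a ^∞ * b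

{-# OPTIONS --safe #-}
module Submission where

-- The natural order is a partial order with top 1 in which + is the join
-- and multiplication is monotone and decreasing.  Taking c = 0 in the
-- induction axiom makes a^∞ the greatest b with b ≤ a b, so _^∞ is
-- monotone; this gives a^∞ + b^∞ ≤ (a+b)^∞ and, with a^∞ a^∞ ≈ a^∞,
-- (ab)^∞ ≤ a^∞ b^∞.  Conversely a^∞ b^∞ ≤ ab · a^∞ b^∞, and two applications
-- of the induction axiom to (a+b)^∞ ≈ b (a+b)^∞ + a (a+b)^∞ bound (a+b)^∞
-- by a^∞ + b^∞.

open import Defs
open import Level using (_⊔_)
open import Data.Nat.Base using (ℕ; zero; suc)
open import Data.Product using (_×_; _,_)
open import Algebra.Bundles using (CommutativeSemiring)
open import Relation.Binary.Bundles using (Poset)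
import Relation.Binary.Reasoning.Setoid as SetoidReasoning
import Relation.Binary.Reasoning.PartialOrder as PosetReasoning
import Algebra.Definitions.RawSemiring as RawSemiringDefinitions
import Algebra.Properties.CommutativeSemigroup as CommutativeSemigroupProperties

module _ {c ℓ} (R : CommutativeSemiring c ℓ) where
  open CommutativeSemiring R
  open RawSemiringDefinitions rawSemiring using (_^_)
  open SetoidReasoning setoid

  ax≈x⇒aⁿx≈x : ∀ {a x} → a * x ≈ x → ∀ n → a ^ n * x ≈ x
  ax≈x⇒aⁿx≈x {a} {x} ax≈x zero    = *-identityˡ x
  ax≈x⇒aⁿx≈x {a} {x} ax≈x (suc n) = begin
    a * a ^ n * x   ≈⟨ *-assoc a (a ^ n) x ⟩
    a * (a ^ n * x) ≈⟨ *-congˡ (ax≈x⇒aⁿx≈x ax≈x n) ⟩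
    a * x           ≈⟨ ax≈x ⟩
    x               ∎

Absorptive : ∀ {c ℓ} → CommutativeSemiring c ℓ → Set (c ⊔ ℓ)
Absorptive R = ∀ a → 1# + a ≈ 1#
  where open CommutativeSemiring R

module AbsorptiveOrder {c ℓ} (R : CommutativeSemiring c ℓ) (absorptive : Absorptive R) where
  open CommutativeSemiring R
  open SetoidReasoning setoid

  infix 4 _≤_
  _≤_ : Carrier → Carrier → Set ℓ
  x ≤ y = x + y ≈ y

  +-idem : ∀ x → x + x ≈ x
  +-idem x = begin
    x + x             ≈⟨ +-cong (*-identityʳ x) (*-identityʳ x) ⟨
    x * 1# + x * 1#   ≈⟨ distribˡ x 1# 1# ⟨
    x * (1# + 1#)     ≈⟨ *-congˡ (absorptive 1#) ⟩
    x * 1#            ≈⟨ *-identityʳ x ⟩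
    x                 ∎

  ≤-reflexive : ∀ {x y} → x ≈ y → x ≤ y
  ≤-reflexive {x} {y} x≈y = trans (+-congʳ x≈y) (+-idem y)

  ≤-trans : ∀ {x y z} → x ≤ y → y ≤ z → x ≤ z
  ≤-trans {x} {y} {z} x≤y y≤z = begin
    x + z       ≈⟨ +-congˡ y≤z ⟨
    x + (y + z) ≈⟨ +-assoc x y z ⟨
    x + y + z   ≈⟨ +-congʳ x≤y ⟩
    y + z       ≈⟨ y≤z ⟩
    z           ∎

  ≤-antisym : ∀ {x y} → x ≤ y → y ≤ x → x ≈ y
  ≤-antisym {x} {y} x≤y y≤x = begin
    x     ≈⟨ y≤x ⟨
    y + x ≈⟨ +-comm y x ⟩
    x + y ≈⟨ x≤y ⟩
    y     ∎

  poset : Poset c ℓ ℓ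
  poset = record
    { isPartialOrder = record
      { isPreorder = record
        { isEquivalence = isEquivalence
        ; reflexive     = ≤-reflexive
        ; trans         = ≤-trans
        }
      ; antisym = ≤-antisym
      }
    }

  x≤1 : ∀ x → x ≤ 1#
  x≤1 x = trans (+-comm x 1#) (absorptive x)

  x≤x+y : ∀ x y → x ≤ x + y
  x≤x+y x y = begin
    x + (x + y) ≈⟨ +-assoc x x y ⟨
    x + x + y   ≈⟨ +-congʳ (+-idem x) ⟩
    x + y       ∎

  y≤x+y : ∀ x y → y ≤ x + y
  y≤x+y x y = trans (+-congˡ (+-comm x y)) (trans (x≤x+y y x) (+-comm y x))

  +-least : ∀ {x y z} → x ≤ z → y ≤ z → x + y ≤ z
  +-least {x} {y} {z} x≤z y≤z = begin
    x + y + z   ≈⟨ +-assoc x y z ⟩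
    x + (y + z) ≈⟨ +-congˡ y≤z ⟩
    x + z       ≈⟨ x≤z ⟩
    z           ∎

  +-mono-≤ : ∀ {x y u v} → x ≤ y → u ≤ v → x + u ≤ y + v
  +-mono-≤ {x} {y} {u} {v} x≤y u≤v =
    +-least (≤-trans x≤y (x≤x+y y v)) (≤-trans u≤v (y≤x+y y v))

  *-monoʳ-≤ : ∀ z {x y} → x ≤ y → z * x ≤ z * y
  *-monoʳ-≤ z {x} {y} x≤y = trans (sym (distribˡ z x y)) (*-congˡ x≤y)

  *-monoˡ-≤ : ∀ z {x y} → x ≤ y → x * z ≤ y * z
  *-monoˡ-≤ z {x} {y} x≤y = begin
    x * z + y * z ≈⟨ +-cong (*-comm x z) (*-comm y z) ⟩
    z * x + z * y ≈⟨ *-monoʳ-≤ z x≤y ⟩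
    z * y         ≈⟨ *-comm z y ⟩
    y * z         ∎

  *-mono-≤ : ∀ {x y u v} → x ≤ y → u ≤ v → x * u ≤ y * v
  *-mono-≤ {x} {y} {u} {v} x≤y u≤v = ≤-trans (*-monoˡ-≤ u x≤y) (*-monoʳ-≤ y u≤v)

  x*y≤x : ∀ x y → x * y ≤ x
  x*y≤x x y = ≤-trans (*-monoʳ-≤ x (x≤1 y)) (≤-reflexive (*-identityʳ x))

  x*y≤y : ∀ x y → x * y ≤ y
  x*y≤y x y = ≤-trans (≤-reflexive (*-comm x y)) (x*y≤x y x)

module InfAlgebraProperties {c ℓ} (K : InfAlgebra c ℓ) where
  open InfAlgebra K
  open AbsorptiveOrder commutativeSemiring absorptive
    hiding (_≤_)
  open PosetReasoning poset
  open CommutativeSemigroupProperties *-commutativeSemigroup using (x∙yz≈y∙xz)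

  b≤ab⇒b≤a^∞b : ∀ {a b} → b ≤ a * b → b ≤ a ^∞ * b
  b≤ab⇒b≤a^∞b {a} {b} b≤ab = begin
    b              ≤⟨ ^∞-induct a b 0# (≤-trans b≤ab (≤-reflexive (sym (+-identityˡ (a * b))))) ⟩
    0# + a ^∞ * b  ≈⟨ +-identityˡ (a ^∞ * b) ⟩
    a ^∞ * b       ∎

  b≤ab⇒b≤a^∞ : ∀ {a b} → b ≤ a * b → b ≤ a ^∞
  b≤ab⇒b≤a^∞ {a} {b} b≤ab = ≤-trans (b≤ab⇒b≤a^∞b b≤ab) (x*y≤x (a ^∞) b)

  a^∞≤a : ∀ a → a ^∞ ≤ a
  a^∞≤a a = ≤-trans (≤-reflexive (^∞-unfold a)) (x*y≤x a (a ^∞))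

  aⁿa^∞≈a^∞ : ∀ a n → a ^ n * a ^∞ ≈ a ^∞
  aⁿa^∞≈a^∞ a = ax≈x⇒aⁿx≈x commutativeSemiring (sym (^∞-unfold a))

  a^∞≤aⁿ : ∀ a n → a ^∞ ≤ a ^ n
  a^∞≤aⁿ a n = ≤-trans (≤-reflexive (sym (aⁿa^∞≈a^∞ a n))) (x*y≤x (a ^ n) (a ^∞))

  ^∞-mono-≤ : ∀ {a b} → a ≤ b → a ^∞ ≤ b ^∞
  ^∞-mono-≤ {a} {b} a≤b = b≤ab⇒b≤a^∞ (begin
    a ^∞       ≈⟨ ^∞-unfold a ⟩
    a * a ^∞   ≤⟨ *-monoˡ-≤ (a ^∞) a≤b ⟩
    b * a ^∞   ∎)

  a^∞a^∞≈a^∞ : ∀ a → a ^∞ * a ^∞ ≈ a ^∞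
  a^∞a^∞≈a^∞ a = ≤-antisym
    (x*y≤x (a ^∞) (a ^∞))
    (b≤ab⇒b≤a^∞b (≤-reflexive (^∞-unfold a)))

  a^∞^∞≈a^∞ : ∀ a → a ^∞ ^∞ ≈ a ^∞
  a^∞^∞≈a^∞ a = ≤-antisym
    (a^∞≤a (a ^∞))
    (b≤ab⇒b≤a^∞ (≤-reflexive (sym (a^∞a^∞≈a^∞ a))))

  [ab]^∞≈a^∞b^∞ : ∀ a b → (a * b) ^∞ ≈ a ^∞ * b ^∞
  [ab]^∞≈a^∞b^∞ a b = ≤-antisym
    (begin
      (a * b) ^∞             ≈⟨ a^∞a^∞≈a^∞ (a * b) ⟨
      (a * b) ^∞ * (a * b) ^∞ ≤⟨ *-mono-≤ (^∞-mono-≤ (x*y≤x a b)) (^∞-mono-≤ (x*y≤y a b)) ⟩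
      a ^∞ * b ^∞             ∎)
    (b≤ab⇒b≤a^∞ (≤-reflexive a^∞b^∞≈ab·a^∞b^∞))
    where
    a^∞b^∞≈ab·a^∞b^∞ : a ^∞ * b ^∞ ≈ (a * b) * (a ^∞ * b ^∞)
    a^∞b^∞≈ab·a^∞b^∞ = begin-equality
      a ^∞ * b ^∞               ≈⟨ *-cong (^∞-unfold a) (^∞-unfold b) ⟩
      (a * a ^∞) * (b * b ^∞)   ≈⟨ *-assoc a (a ^∞) (b * b ^∞) ⟩
      a * (a ^∞ * (b * b ^∞))   ≈⟨ *-congˡ (x∙yz≈y∙xz (a ^∞) b (b ^∞)) ⟩
      a * (b * (a ^∞ * b ^∞))   ≈⟨ *-assoc a b (a ^∞ * b ^∞) ⟨
      (a * b) * (a ^∞ * b ^∞)   ∎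

  [a+b]^∞≈a^∞+b^∞ : ∀ a b → (a + b) ^∞ ≈ a ^∞ + b ^∞
  [a+b]^∞≈a^∞+b^∞ a b = ≤-antisym
    (begin
      u                   ≤⟨ ^∞-induct b u (a ^∞ * u) u≤a^∞u+bu ⟩
      a ^∞ * u + b ^∞ * u ≤⟨ +-mono-≤ (x*y≤x (a ^∞) u) (x*y≤x (b ^∞) u) ⟩
      a ^∞ + b ^∞         ∎)
    (+-least (^∞-mono-≤ (x≤x+y a b)) (^∞-mono-≤ (y≤x+y a b)))
    where
    u : Carrier
    u = (a + b) ^∞
    u≈bu+au : u ≈ b * u + a * u
    u≈bu+au = begin-equality
      u             ≈⟨ ^∞-unfold (a + b) ⟩
      (a + b) * u   ≈⟨ distribʳ u a b ⟩
      a * u + b * u ≈⟨ +-comm (a * u) (b * u) ⟩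
      b * u + a * u ∎
    u≤a^∞u+bu : u ≤ a ^∞ * u + b * u
    u≤a^∞u+bu = begin
      u                ≤⟨ ^∞-induct a u (b * u) (≤-reflexive u≈bu+au) ⟩
      b * u + a ^∞ * u ≈⟨ +-comm (b * u) (a ^∞ * u) ⟩
      a ^∞ * u + b * u ∎

lemmaB4 : ∀ {c ℓ} (K : InfAlgebra c ℓ) → let open InfAlgebra K in
    ∀ (a b : Carrier) →
      (∀ (n : ℕ) → (a ^∞ ≤ a ^ n) × (a ^ n * a ^∞ ≈ a ^∞))
      × (a ^∞ * a ^∞ ≈ a ^∞)
      × ((a ^∞) ^∞ ≈ a ^∞)
      × ((a * b) ^∞ ≈ a ^∞ * b ^∞)
      × ((a + b) ^∞ ≈ a ^∞ + b ^∞)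
lemmaB4 K a b =
  (λ n → a^∞≤aⁿ a n , aⁿa^∞≈a^∞ a n) ,
  a^∞a^∞≈a^∞ a ,
  a^∞^∞≈a^∞ a ,
  [ab]^∞≈a^∞b^∞ a b ,
  [a+b]^∞≈a^∞+b^∞ a b
  where open InfAlgebraProperties K
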